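{- For every integer $n>1$ and every odd integer $q\ge 3$ there exists a $2$-stochastic $(n+2)$-dimensional matrix of order $q$ whose permanent is zero.
   Context: An $d$-dimensional matrix of order $q$ is an array $M=(M(\alpha))_{\alpha\in\{1,\dots,q\}^d}$ of real numbers. A $t$-dimensional plane of $M$ is the set of entries obtained by fixing $d-t$ of the coordinates at given values. $M$ is $t$-stochastic if it is nonnegative and the sums of entries over all $t$-dimensional planes are equal. A diagonal of $M$ is a set of $q$ entries $\alpha^1,\dots,\alpha^q$ such that for each coordinate $s\in\{1,\dots,d\}$ the values $\alpha^1_s,\dots,\alpha^q_s$ are pairwise distinct. The permanent of $M$ is the sum, over all diagonals, of the product of the entries of the diagonal. -}

module Defs where

open import Data.Nat using (ℕ; zero; suc)
open import Data.Fin using (Fin; zero; suc; _≟_)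
open import Data.Bool using (Bool; true; false; _∨_; _∧_; not; if_then_else_)
open import Data.List using (List; []; _∷_; [_]; map; concatMap; foldr; allFin; length)
open import Data.Vec.Functional using () renaming (_∷_ to _∷ᶠ_)
open import Data.Rational using (ℚ; 0ℚ; 1ℚ; _+_; _*_; _≤_)
open import Data.Product using (_×_)
open import Relation.Nullary.Decidable using (⌊_⌋)
open import Relation.Binary.PropositionalEquality using (_≡_)

filterᵇ : {A : Set} → (A → Bool) → List A → List A
filterᵇ p [] = []
filterᵇ p (x ∷ xs) = if p x then x ∷ filterᵇ p xs else filterᵇ p xs

allᵇ : {A : Set} → (A → Bool) → List A → Bool
allᵇ p [] = true
allᵇ p (x ∷ xs) = p x ∧ allᵇ p xs

allFuns : {A : Set} (n : ℕ) → List A → List (Fin n → A)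
allFuns zero xs = [ (λ ()) ]
allFuns (suc n) xs = concatMap (λ a → map (λ f → a ∷ᶠ f) (allFuns n xs)) xs

-- indices α ∈ {1..q}^d, and d-dimensional matrices of order q with real (here rational) entries
Index : ℕ → ℕ → Set
Index d q = Fin d → Fin q

Matrix : ℕ → ℕ → Set
Matrix d q = Index d q → ℚ

allIndices : (d q : ℕ) → List (Index d q)
allIndices d q = allFuns d (allFin q)

sumℚ : List ℚ → ℚ
sumℚ = foldr _+_ 0ℚ

prodℚ : List ℚ → ℚ
prodℚ = foldr _*_ 1ℚ

-- A plane is given by the set of free coordinates (free s = true) and a point α
-- giving the values of the fixed coordinates. β lies on it iff β agrees with α
-- on all non-free coordinates.
onPlane : {d q : ℕ} → (Fin d → Bool) → Index d q → Index d q → Bool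
onPlane {d} free α β = allᵇ (λ s → free s ∨ ⌊ α s ≟ β s ⌋) (allFin d)

numFree : {d : ℕ} → (Fin d → Bool) → ℕ
numFree {d} free = length (filterᵇ free (allFin d))

planeSum : {d q : ℕ} → Matrix d q → (Fin d → Bool) → Index d q → ℚ
planeSum {d} {q} M free α = sumℚ (map M (filterᵇ (onPlane free α) (allIndices d q)))

IsStochastic : {d q : ℕ} → ℕ → Matrix d q → Set
IsStochastic {d} {q} t M =
  ((α : Index d q) → 0ℚ ≤ M α) ×
  ((free : Fin d → Bool) (α : Index d q) → numFree free ≡ t → planeSum M free α ≡ 1ℚ)

-- A diagonal is a set of q indices α¹..α^q such that for each coordinate s the
-- values α¹_s..α^q_s are pairwise distinct. Each such set is represented exactly
-- once by the family D : Fin q → Index d q listed so that D k has first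
-- coordinate k.
isDiagonalᵇ : {d q : ℕ} → (Fin q → Index (suc d) q) → Bool
isDiagonalᵇ {d} {q} D =
  allᵇ (λ k → ⌊ D k zero ≟ k ⌋) (allFin q) ∧
  allᵇ (λ s → allᵇ (λ k → allᵇ (λ l → ⌊ k ≟ l ⌋ ∨ not ⌊ D k s ≟ D l s ⌋) (allFin q)) (allFin q))
      (allFin (suc d))

diagonals : (d q : ℕ) → List (Fin q → Index (suc d) q)
diagonals d q = filterᵇ isDiagonalᵇ (allFuns q (allIndices (suc d) q))

permanent : {d q : ℕ} → Matrix (suc d) q → ℚ
permanent {d} {q} M = sumℚ (map (λ D → prodℚ (map (λ k → M (D k)) (allFin q))) (diagonals d q))

-- Index coordinates by 0,…,d and values by 0,…,q-1, and give an index β the weight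
-- [β₀ = 0] + β₁ + ⋯ + β_d. The matrix is 1/q on the indices whose weight is divisible by q
-- and 0 elsewhere. Fixing all of β₁,…,β_d but one, exactly one value of the remaining
-- coordinate makes the weight divisible by q; a 2-plane always frees at least one of
-- β₁,…,β_d, so it contains exactly q such indices and sums to 1. Along a diagonal the
-- first coordinate and every other coordinate run through all of 0,…,q-1, so the weights
-- of its entries add up to 1 + d·q(q-1)/2, which is 1 modulo an odd q. Hence some entry
-- of every diagonal is 0, and the permanent vanishes.
module Submission where

open import Defs
open import Data.Nat using (ℕ; _+_; _*_; _<_; _≤_)
open import Data.Rational using (0ℚ)
open import Data.Product using (Σ; ∃; _×_)
open import Relation.Binary.PropositionalEquality using (_≡_)

open import Algebra.Bundles using (CommutativeRing)
import Algebra.Properties.CommutativeMonoid.Sum as CommutativeMonoidSum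
import Algebra.Properties.Semiring.Mult as SemiringMult
open import Data.Bool using (Bool; true; false; _∧_; _∨_; not; if_then_else_)
open import Data.Bool.Properties using (∧-conicalˡ; ∧-conicalʳ; ∧-assoc; ∨-identityʳ)
open import Data.Fin using (Fin; zero; suc; toℕ; fromℕ<; punchOut) renaming (_≟_ to _≟ᶠ_)
open import Data.Fin.Permutation using (permutation)
open import Data.Fin.Properties using (toℕ<n; toℕ-injective; toℕ-fromℕ<; any?; injective⇒≤; punchOut-injective; suc-injective)
open import Data.List using (List; []; _∷_; _++_; map; concatMap; tabulate; allFin; length)
open import Data.List.Properties using (map-tabulate)
open import Data.Nat using (zero; suc; _^_; _∸_; _%_; _/_; s≤s; z≤n)
open import Data.Nat.Divisibility using (_∣_; _∣?_; divides; m∣m*n; ∣m+n∣m⇒∣n; ∣m∣n⇒∣m+n; _∣0; ∣1⇒≡1; n∣m*n; ∣n⇒∣m*n; >⇒∤)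
open import Data.Nat.DivMod using (m≡m%n+[m/n]*n; m%n<n)
import Data.Nat.Properties as ℕₚ
open import Data.Nat.Tactic.RingSolver using (solve-∀)
open import Data.Product using (_,_; proj₁; proj₂)
open import Data.Sum using (_⊎_; inj₁; inj₂)
open import Data.Vec.Functional using () renaming (_∷_ to _∷ᶠ_)
import Data.Rational as ℚ
import Data.Rational.Properties as ℚₚ
open import Function using (_∘_; id)
open import Function.Definitions using (Injective)
open import Relation.Nullary using (¬_; Dec; yes; no; contradiction)
open import Relation.Nullary.Decidable using (⌊_⌋)
open import Relation.Binary.PropositionalEquality using (refl; sym; trans; cong; cong₂; subst; _≢_; module ≡-Reasoning)

open CommutativeMonoidSum ℕₚ.+-0-commutativeMonoid using (sum; sum-cong-≗; sum-replicate-zero; ∑-distrib-+; ∑-comm; ∑-permute)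
open SemiringMult (CommutativeRing.semiring ℚₚ.+-*-commutativeRing) using (×-assoc-*) renaming (_×_ to _×ℚ_)

isYes⇒ : {P : Set} (P? : Dec P) → ⌊ P? ⌋ ≡ true → P
isYes⇒ (yes p) _ = p
isYes⇒ (no _) ()

isYes-yes : {P : Set} (P? : Dec P) → P → ⌊ P? ⌋ ≡ true
isYes-yes (yes _) _ = refl
isYes-yes (no ¬p) p = contradiction p ¬p

isYes-no : {P : Set} (P? : Dec P) → ¬ P → ⌊ P? ⌋ ≡ false
isYes-no (yes p) ¬p = contradiction p ¬p
isYes-no (no _) _ = refl

count : {A : Set} → (A → Bool) → List A → ℕ
count p xs = length (filterᵇ p xs)

private
  variable
    A B : Set

count-cong : {p r : A → Bool} → (∀ x → p x ≡ r x) → ∀ xs → count p xs ≡ count r xs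
count-cong p≗r [] = refl
count-cong {r = r} p≗r (x ∷ xs) rewrite p≗r x with r x
... | true = cong suc (count-cong p≗r xs)
... | false = count-cong p≗r xs

count-++ : ∀ (p : A → Bool) xs ys → count p (xs ++ ys) ≡ count p xs + count p ys
count-++ p [] ys = refl
count-++ p (x ∷ xs) ys with p x
... | true = cong suc (count-++ p xs ys)
... | false = count-++ p xs ys

count-const-false : ∀ (xs : List A) → count (λ _ → false) xs ≡ 0
count-const-false [] = refl
count-const-false (x ∷ xs) = count-const-false xs

count-guarded : ∀ b (p : A → Bool) xs → count (λ x → b ∧ p x) xs ≡ (if b then count p xs else 0)
count-guarded true p xs = refl
count-guarded false p xs = count-const-false xs

count-map : ∀ (p : B → Bool) (f : A → B) xs → count p (map f xs) ≡ count (p ∘ f) xs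
count-map p f [] = refl
count-map p f (x ∷ xs) with p (f x)
... | true = cong suc (count-map p f xs)
... | false = count-map p f xs

count-concatMap-tabulate : ∀ {n} (p : B → Bool) (g : A → List B) (f : Fin n → A) →
  count p (concatMap g (tabulate f)) ≡ sum (λ i → count p (g (f i)))
count-concatMap-tabulate {n = zero} p g f = refl
count-concatMap-tabulate {n = suc n} p g f =
  trans (count-++ p (g (f zero)) _) (cong (count p (g (f zero)) +_) (count-concatMap-tabulate p g (f ∘ suc)))

allᵇ-map : ∀ (p : B → Bool) (f : A → B) xs → allᵇ p (map f xs) ≡ allᵇ (p ∘ f) xs
allᵇ-map p f [] = refl
allᵇ-map p f (x ∷ xs) = cong (p (f x) ∧_) (allᵇ-map p f xs)

allᵇ-tabulate⁻ : ∀ {n} {p : A → Bool} (f : Fin n → A) → allᵇ p (tabulate f) ≡ true → ∀ i → p (f i) ≡ true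
allᵇ-tabulate⁻ f all zero = ∧-conicalˡ _ _ all
allᵇ-tabulate⁻ f all (suc i) = allᵇ-tabulate⁻ (f ∘ suc) (∧-conicalʳ _ _ all) i

allᵇ-allFin⁻ : ∀ {n} {p : Fin n → Bool} → allᵇ p (allFin n) ≡ true → ∀ i → p i ≡ true
allᵇ-allFin⁻ = allᵇ-tabulate⁻ id

tabulate-suc : ∀ n → tabulate {A = Fin (suc n)} suc ≡ map suc (allFin n)
tabulate-suc n = sym (map-tabulate id (Data.Fin.suc {n}))

sum-const : ∀ n c → sum {n} (λ _ → c) ≡ n * c
sum-const zero c = refl
sum-const (suc n) c = cong (c +_) (sum-const n c)

sum-concentrated : ∀ {n} (f : Fin n → ℕ) i → (∀ j → j ≢ i → f j ≡ 0) → sum f ≡ f i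
sum-concentrated {suc n} f zero off = begin
  f zero + sum (f ∘ suc)     ≡⟨ cong (f zero +_) (sum-cong-≗ (λ j → off (suc j) (λ ()))) ⟩
  f zero + sum {n} (λ _ → 0) ≡⟨ cong (f zero +_) (sum-replicate-zero n) ⟩
  f zero + 0                 ≡⟨ ℕₚ.+-identityʳ (f zero) ⟩
  f zero                     ∎
  where open ≡-Reasoning
sum-concentrated {suc n} f (suc i) off =
  cong₂ _+_ (off zero (λ ())) (sum-concentrated (f ∘ suc) i (λ j j≢i → off (suc j) (j≢i ∘ suc-injective)))

∣-sum : ∀ {q n} (f : Fin n → ℕ) → (∀ i → q ∣ f i) → q ∣ sum f
∣-sum {q} {zero} f q∣f = q ∣0
∣-sum {q} {suc n} f q∣f = ∣m∣n⇒∣m+n (q∣f zero) (∣-sum (f ∘ suc) (q∣f ∘ suc))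

injective⇒surjective : ∀ {n} {f : Fin n → Fin n} → Injective _≡_ _≡_ f → ∀ y → ∃ λ x → f x ≡ y
injective⇒surjective {suc n} {f} f-inj y with any? (λ x → f x ≟ᶠ y)
... | yes hit = hit
... | no miss = contradiction (injective⇒≤ punchOut-inj) ℕₚ.1+n≰n
  where
  avoids : ∀ x → y ≢ f x
  avoids x y≡fx = miss (x , sym y≡fx)
  punchOut-inj : Injective _≡_ _≡_ (λ x → punchOut (avoids x))
  punchOut-inj eq = f-inj (punchOut-injective (avoids _) (avoids _) eq)

sum-reindex-injective : ∀ {n} (g : Fin n → ℕ) {f : Fin n → Fin n} → Injective _≡_ _≡_ f → sum (g ∘ f) ≡ sum g
sum-reindex-injective g {f} f-inj = sym (∑-permute g π)
  where
  f⁻¹ = λ y → proj₁ (injective⇒surjective f-inj y)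
  π = permutation f f⁻¹ (λ y → proj₂ (injective⇒surjective f-inj y)) (λ x → f-inj (proj₂ (injective⇒surjective f-inj (f x))))

twice-sum-toℕ : ∀ n → 2 * sum {n} toℕ + n ≡ n * n
twice-sum-toℕ zero = refl
twice-sum-toℕ (suc n) = begin
  2 * sum {suc n} toℕ + suc n      ≡⟨ cong (λ s → 2 * s + suc n) sum-toℕ-suc ⟩
  2 * (n + T) + suc n              ≡⟨ regroup n T ⟩
  (2 * T + n) + (2 * n + 1)        ≡⟨ cong (_+ (2 * n + 1)) (twice-sum-toℕ n) ⟩
  n * n + (2 * n + 1)              ≡⟨ square-suc n ⟩
  suc n * suc n                    ∎
  where
  open ≡-Reasoning
  T = sum {n} toℕ
  sum-toℕ-suc : sum {suc n} toℕ ≡ n + T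
  sum-toℕ-suc = trans (∑-distrib-+ {n} (λ _ → 1) toℕ) (cong (_+ T) (trans (sum-const n 1) (ℕₚ.*-identityʳ n)))
  regroup : ∀ n T → 2 * (n + T) + suc n ≡ (2 * T + n) + (2 * n + 1)
  regroup = solve-∀
  square-suc : ∀ n → n * n + (2 * n + 1) ≡ suc n * suc n
  square-suc = solve-∀

odd∣sum-toℕ : ∀ h → 1 + 2 * h ∣ sum {1 + 2 * h} toℕ
odd∣sum-toℕ h = divides h (ℕₚ.*-cancelˡ-≡ _ _ 2 (ℕₚ.+-cancelʳ-≡ q _ _ (trans (twice-sum-toℕ q) (square-odd h))))
  where
  q = 1 + 2 * h
  square-odd : ∀ h → (1 + 2 * h) * (1 + 2 * h) ≡ 2 * (h * (1 + 2 * h)) + (1 + 2 * h)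
  square-odd = solve-∀

δ₀ : ∀ {n} → Fin n → ℕ
δ₀ zero = 1
δ₀ (suc _) = 0

sum-δ₀ : ∀ n → sum {suc n} δ₀ ≡ 1
sum-δ₀ n = cong suc (trans (sum-const n 0) (ℕₚ.*-zeroʳ n))

module _ {d : ℕ} where

  numFree-tail : ∀ (free : Fin (suc d) → Bool) → count free (tabulate suc) ≡ numFree (free ∘ suc)
  numFree-tail free = trans (cong (count free) (tabulate-suc d)) (count-map free suc (allFin d))

  numFree-head : ∀ (free : Fin (suc d) → Bool) {k} → numFree free ≡ k →
    (free zero ≡ true × suc (numFree (free ∘ suc)) ≡ k) ⊎ (free zero ≡ false × numFree (free ∘ suc) ≡ k)
  numFree-head free dim with free zero
  ... | true = inj₁ (refl , trans (cong suc (sym (numFree-tail free))) dim)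
  ... | false = inj₂ (refl , trans (sym (numFree-tail free)) dim)

module _ {d q : ℕ} where

  onPlane-∷ : ∀ (free : Fin (suc d) → Bool) (α : Index (suc d) q) a (β : Index d q) →
    onPlane free α (a ∷ᶠ β) ≡ (free zero ∨ ⌊ α zero ≟ᶠ a ⌋) ∧ onPlane (free ∘ suc) (α ∘ suc) β
  onPlane-∷ free α a β = cong (_ ∧_) (trans (cong (allᵇ _) (tabulate-suc d)) (allᵇ-map _ suc (allFin d)))

  count-allIndices-suc : (P : Index (suc d) q → Bool) →
    count P (allIndices (suc d) q) ≡ sum (λ a → count (λ β → P (a ∷ᶠ β)) (allIndices d q))
  count-allIndices-suc P = trans (count-concatMap-tabulate P (λ a → map (a ∷ᶠ_) (allIndices d q)) id)
    (sum-cong-≗ (λ a → count-map P (a ∷ᶠ_) (allIndices d q)))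

  module _ (free : Fin (suc d) → Bool) (α : Index (suc d) q) (P : Index (suc d) q → Bool) where

    private
      onSlice : Fin q → ℕ
      onSlice a = count (λ β → onPlane (free ∘ suc) (α ∘ suc) β ∧ P (a ∷ᶠ β)) (allIndices d q)

    count-onPlane-∷ : count (λ β → onPlane free α β ∧ P β) (allIndices (suc d) q) ≡
      sum (λ a → if free zero ∨ ⌊ α zero ≟ᶠ a ⌋ then onSlice a else 0)
    count-onPlane-∷ = trans (count-allIndices-suc _) (sum-cong-≗ slice)
      where
      slice : ∀ a → count (λ β → onPlane free α (a ∷ᶠ β) ∧ P (a ∷ᶠ β)) (allIndices d q) ≡
        (if free zero ∨ ⌊ α zero ≟ᶠ a ⌋ then onSlice a else 0)
      slice a = trans
        (count-cong (λ β → trans (cong (_∧ P (a ∷ᶠ β)) (onPlane-∷ free α a β))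
                                 (∧-assoc (free zero ∨ ⌊ α zero ≟ᶠ a ⌋) _ (P (a ∷ᶠ β)))) (allIndices d q))
        (count-guarded _ _ (allIndices d q))

    count-onPlane-free : free zero ≡ true →
      count (λ β → onPlane free α β ∧ P β) (allIndices (suc d) q) ≡ sum onSlice
    count-onPlane-free eq = trans count-onPlane-∷
      (sum-cong-≗ (λ a → cong (λ b → if b ∨ ⌊ α zero ≟ᶠ a ⌋ then onSlice a else 0) eq))

    count-onPlane-fixed : free zero ≡ false →
      count (λ β → onPlane free α β ∧ P β) (allIndices (suc d) q) ≡ onSlice (α zero)
    count-onPlane-fixed eq = begin
      count (λ β → onPlane free α β ∧ P β) (allIndices (suc d) q)
        ≡⟨ count-onPlane-∷ ⟩
      sum (λ a → if free zero ∨ ⌊ α zero ≟ᶠ a ⌋ then onSlice a else 0)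
        ≡⟨ sum-cong-≗ (λ a → cong (λ b → if b ∨ ⌊ α zero ≟ᶠ a ⌋ then onSlice a else 0) eq) ⟩
      sum (λ a → if ⌊ α zero ≟ᶠ a ⌋ then onSlice a else 0)
        ≡⟨ sum-concentrated _ (α zero) off ⟩
      (if ⌊ α zero ≟ᶠ α zero ⌋ then onSlice (α zero) else 0)
        ≡⟨ cong (if_then onSlice (α zero) else 0) (isYes-yes (α zero ≟ᶠ α zero) refl) ⟩
      onSlice (α zero) ∎
      where
      open ≡-Reasoning
      off : ∀ a → a ≢ α zero → (if ⌊ α zero ≟ᶠ a ⌋ then onSlice a else 0) ≡ 0
      off a a≢α₀ rewrite isYes-no (α zero ≟ᶠ a) (a≢α₀ ∘ sym) = refl

module _ {d q : ℕ} {D : Fin q → Index (suc d) q} (diagonal : isDiagonalᵇ D ≡ true) where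

  private
    distinctAt : Fin (suc d) → Fin q → Fin q → Bool
    distinctAt s k l = ⌊ k ≟ᶠ l ⌋ ∨ not ⌊ D k s ≟ᶠ D l s ⌋

    distinct : ∀ s k l → distinctAt s k l ≡ true
    distinct s k l = allᵇ-allFin⁻ {p = distinctAt s k}
      (allᵇ-allFin⁻ {p = λ k → allᵇ (distinctAt s k) (allFin q)}
        (allᵇ-allFin⁻ {p = λ s → allᵇ (λ k → allᵇ (distinctAt s k) (allFin q)) (allFin q)}
          (∧-conicalʳ (allᵇ (λ k → ⌊ D k zero ≟ᶠ k ⌋) (allFin q)) _ diagonal) s) k) l

  diagonal-head : ∀ k → D k zero ≡ k
  diagonal-head k = isYes⇒ (D k zero ≟ᶠ k) (allᵇ-allFin⁻ {p = λ k → ⌊ D k zero ≟ᶠ k ⌋} (∧-conicalˡ _ _ diagonal) k)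

  diagonal-column-injective : ∀ s → Injective _≡_ _≡_ (λ k → D k s)
  diagonal-column-injective s {k} {l} Dks≡Dls = isYes⇒ (k ≟ᶠ l) (begin
    ⌊ k ≟ᶠ l ⌋                              ≡⟨ sym (∨-identityʳ _) ⟩
    ⌊ k ≟ᶠ l ⌋ ∨ not true                   ≡⟨ cong (λ b → ⌊ k ≟ᶠ l ⌋ ∨ not b) (sym (isYes-yes (D k s ≟ᶠ D l s) Dks≡Dls)) ⟩
    distinctAt s k l                         ≡⟨ distinct s k l ⟩
    true                                     ∎)
    where open ≡-Reasoning

indicator : (A → Bool) → ℚ.ℚ → A → ℚ.ℚ
indicator S v x = if S x then v else 0ℚ

indicator-in : ∀ (S : A → Bool) {v x} → S x ≡ true → indicator S v x ≡ v
indicator-in S Sx = cong (if_then _ else 0ℚ) Sx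

indicator-out : ∀ (S : A → Bool) {v x} → S x ≡ false → indicator S v x ≡ 0ℚ
indicator-out S Sx = cong (if_then _ else 0ℚ) Sx

indicator-nonNeg : ∀ (S : A → Bool) {v} → 0ℚ ℚ.≤ v → ∀ x → 0ℚ ℚ.≤ indicator S v x
indicator-nonNeg S 0≤v x with S x
... | true = 0≤v
... | false = ℚₚ.≤-refl

sumℚ-indicator-filter : ∀ (S r : A → Bool) v xs →
  sumℚ (map (indicator S v) (filterᵇ r xs)) ≡ count (λ x → r x ∧ S x) xs ×ℚ v
sumℚ-indicator-filter S r v [] = refl
sumℚ-indicator-filter S r v (x ∷ xs) with r x | S x in Sx
... | true | true = cong₂ ℚ._+_ (indicator-in S Sx) (sumℚ-indicator-filter S r v xs)
... | true | false = trans (cong₂ ℚ._+_ (indicator-out S Sx) (sumℚ-indicator-filter S r v xs)) (ℚₚ.+-identityˡ _)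
... | false | _ = sumℚ-indicator-filter S r v xs

prodℚ-indicator-zero : ∀ (S : A → Bool) v (f : B → A) ks → allᵇ (S ∘ f) ks ≡ false →
  prodℚ (map (indicator S v ∘ f) ks) ≡ 0ℚ
prodℚ-indicator-zero S v f (k ∷ ks) leaves with S (f k)
... | false = ℚₚ.*-zeroˡ (prodℚ (map (indicator S v ∘ f) ks))
... | true = trans (cong (v ℚ.*_) (prodℚ-indicator-zero S v f ks leaves)) (ℚₚ.*-zeroʳ v)

sumℚ-filter-zero : ∀ (g : A → ℚ.ℚ) (p : A → Bool) xs → (∀ x → p x ≡ true → g x ≡ 0ℚ) →
  sumℚ (map g (filterᵇ p xs)) ≡ 0ℚ
sumℚ-filter-zero g p [] _ = refl
sumℚ-filter-zero g p (x ∷ xs) g-zero with p x in px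
... | true = trans (cong₂ ℚ._+_ (g-zero x px) (sumℚ-filter-zero g p xs g-zero)) (ℚₚ.+-identityʳ 0ℚ)
... | false = sumℚ-filter-zero g p xs g-zero

permanent-indicator : ∀ {d q} (S : Index (suc d) q → Bool) v →
  (∀ D → isDiagonalᵇ D ≡ true → allᵇ (S ∘ D) (allFin q) ≡ false) → permanent (indicator S v) ≡ 0ℚ
permanent-indicator {d} {q} S v leaves = sumℚ-filter-zero _ isDiagonalᵇ (allFuns q (allIndices (suc d) q))
  (λ D diagonal → prodℚ-indicator-zero S v D (allFin q) (leaves D diagonal))

×1ℚ-nonNeg : ∀ n → ℚ.NonNegative (n ×ℚ ℚ.1ℚ)
×1ℚ-nonNeg zero = ℚ.nonNegative ℚₚ.≤-refl
×1ℚ-nonNeg (suc n) = ℚₚ.nonNeg+nonNeg⇒nonNeg ℚ.1ℚ (n ×ℚ ℚ.1ℚ) {{×1ℚ-nonNeg n}}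

module Modulo (m : ℕ) where

  q : ℕ
  q = suc m

  divisibleᵇ : ℕ → Bool
  divisibleᵇ x = ⌊ q ∣? x ⌋

  residue-exists : ∀ c → ∃ λ (a : Fin q) → q ∣ toℕ a + c
  -- The witness is (m·c) mod q, because m·c + c = q·c.
  residue-exists c = fromℕ< (m%n<n x q) , subst (λ r → q ∣ r + c) (sym (toℕ-fromℕ< (m%n<n x q))) q∣x%q+c
    where
    x = m * c
    q∣x%q+c : q ∣ x % q + c
    q∣x%q+c = ∣m+n∣m⇒∣n (subst (q ∣_) (begin
        q * c                    ≡⟨ ℕₚ.+-comm c x ⟩
        x + c                    ≡⟨ cong (_+ c) (m≡m%n+[m/n]*n x q) ⟩
        (x % q + x / q * q) + c  ≡⟨ cong (_+ c) (ℕₚ.+-comm (x % q) _) ⟩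
        (x / q * q + x % q) + c  ≡⟨ ℕₚ.+-assoc (x / q * q) (x % q) c ⟩
        x / q * q + (x % q + c)  ∎) (m∣m*n c)) (n∣m*n (x / q))
      where open ≡-Reasoning

  residue-unique-≤ : ∀ {x y} c → x ≤ y → y < q → q ∣ x + c → q ∣ y + c → x ≡ y
  residue-unique-≤ {x} {y} c x≤y y<q q∣x+c q∣y+c = ℕₚ.≤-antisym x≤y (ℕₚ.m∸n≡0⇒m≤n (small-multiple q∣y∸x y∸x<q))
    where
    q∣y∸x : q ∣ y ∸ x
    q∣y∸x = ∣m+n∣m⇒∣n (subst (q ∣_) (begin
        y + c            ≡⟨ cong (_+ c) (sym (ℕₚ.m+[n∸m]≡n x≤y)) ⟩
        x + (y ∸ x) + c  ≡⟨ ℕₚ.+-assoc x (y ∸ x) c ⟩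
        x + (y ∸ x + c)  ≡⟨ cong (x +_) (ℕₚ.+-comm (y ∸ x) c) ⟩
        x + (c + (y ∸ x)) ≡⟨ sym (ℕₚ.+-assoc x c (y ∸ x)) ⟩
        x + c + (y ∸ x)  ∎) q∣y+c) q∣x+c
      where open ≡-Reasoning
    y∸x<q : y ∸ x < q
    y∸x<q = ℕₚ.≤-<-trans (ℕₚ.m∸n≤m y x) y<q
    small-multiple : ∀ {k} → q ∣ k → k < q → k ≡ 0
    small-multiple {zero} _ _ = refl
    small-multiple {suc k} q∣k k<q = contradiction q∣k (>⇒∤ k<q)

  residue-unique : ∀ {a b : Fin q} c → q ∣ toℕ a + c → q ∣ toℕ b + c → a ≡ b
  residue-unique {a} {b} c q∣a+c q∣b+c with ℕₚ.≤-total (toℕ a) (toℕ b)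
  ... | inj₁ a≤b = toℕ-injective (residue-unique-≤ c a≤b (toℕ<n b) q∣a+c q∣b+c)
  ... | inj₂ b≤a = sym (toℕ-injective (residue-unique-≤ c b≤a (toℕ<n a) q∣b+c q∣a+c))

  residue-count : ∀ c → sum (λ (a : Fin q) → if divisibleᵇ (toℕ a + c) then 1 else 0) ≡ 1
  residue-count c = trans (sum-concentrated _ a₀ off) (cong (if_then 1 else 0) (isYes-yes (q ∣? _) q∣a₀+c))
    where
    a₀ = proj₁ (residue-exists c)
    q∣a₀+c = proj₂ (residue-exists c)
    off : ∀ a → a ≢ a₀ → (if divisibleᵇ (toℕ a + c) then 1 else 0) ≡ 0
    off a a≢a₀ with q ∣? toℕ a + c
    ... | yes q∣a+c = contradiction (residue-unique c q∣a+c q∣a₀+c) a≢a₀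
    ... | no _ = refl

  digitSum : ∀ {d} → Index d q → ℕ
  digitSum β = sum (toℕ ∘ β)

  planeSolutions : ∀ {d} → (Fin d → Bool) → Index d q → ℕ → ℕ
  planeSolutions {d} free α c = count (λ β → onPlane free α β ∧ divisibleᵇ (c + digitSum β)) (allIndices d q)

  module _ {d} (free : Fin (suc d) → Bool) (α : Index (suc d) q) (c : ℕ) where

    private
      shift : ∀ (a : Fin q) (β : Index d q) → c + (toℕ a + digitSum β) ≡ (c + toℕ a) + digitSum β
      shift a β = sym (ℕₚ.+-assoc c (toℕ a) (digitSum β))

    planeSolutions-free : free zero ≡ true →
      planeSolutions free α c ≡ sum {q} (λ a → planeSolutions (free ∘ suc) (α ∘ suc) (c + toℕ a))
    planeSolutions-free eq = trans (count-onPlane-free free α (λ β → divisibleᵇ (c + digitSum β)) eq)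
      (sum-cong-≗ {q} (λ a → count-cong (λ β → cong (λ x → onPlane (free ∘ suc) (α ∘ suc) β ∧ divisibleᵇ x) (shift a β))
                                        (allIndices d q)))

    planeSolutions-fixed : free zero ≡ false →
      planeSolutions free α c ≡ planeSolutions (free ∘ suc) (α ∘ suc) (c + toℕ (α zero))
    planeSolutions-fixed eq = trans (count-onPlane-fixed free α (λ β → divisibleᵇ (c + digitSum β)) eq)
      (count-cong (λ β → cong (λ x → onPlane (free ∘ suc) (α ∘ suc) β ∧ divisibleᵇ x) (shift (α zero) β)) (allIndices d q))

  planeSolutions-point : ∀ {d} (free : Fin d → Bool) α c → numFree free ≡ 0 →
    planeSolutions free α c ≡ (if divisibleᵇ (c + digitSum α) then 1 else 0)
  planeSolutions-point {zero} free α c _ with divisibleᵇ (c + 0)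
  ... | true = refl
  ... | false = refl
  planeSolutions-point {suc d} free α c none with numFree-head free none
  ... | inj₁ (_ , ())
  ... | inj₂ (eq , none′) = begin
    planeSolutions free α c
      ≡⟨ planeSolutions-fixed free α c eq ⟩
    planeSolutions (free ∘ suc) (α ∘ suc) (c + toℕ (α zero))
      ≡⟨ planeSolutions-point (free ∘ suc) (α ∘ suc) _ none′ ⟩
    (if divisibleᵇ (c + toℕ (α zero) + digitSum (α ∘ suc)) then 1 else 0)
      ≡⟨ cong (λ x → if divisibleᵇ x then 1 else 0) (ℕₚ.+-assoc c (toℕ (α zero)) _) ⟩
    (if divisibleᵇ (c + digitSum α) then 1 else 0) ∎
    where open ≡-Reasoning

  planeSolutions-plane : ∀ {d t} (free : Fin d → Bool) α c → numFree free ≡ suc t →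
    planeSolutions free α c ≡ q ^ t
  planeSolutions-plane {suc d} {t} free α c dim with numFree-head free dim
  ... | inj₂ (eq , dim′) =
    trans (planeSolutions-fixed free α c eq) (planeSolutions-plane (free ∘ suc) (α ∘ suc) _ dim′)
  ... | inj₁ (eq , dim′) = trans (planeSolutions-free free α c eq) (sum-slices t (ℕₚ.suc-injective dim′))
    where
    sum-slices : ∀ t → numFree (free ∘ suc) ≡ t → sum {q} (λ a → planeSolutions (free ∘ suc) (α ∘ suc) (c + toℕ a)) ≡ q ^ t
    sum-slices zero point = trans
      (sum-cong-≗ {q} (λ a → trans (planeSolutions-point (free ∘ suc) (α ∘ suc) (c + toℕ a) point)
        (cong (λ x → if divisibleᵇ x then 1 else 0) (regroup c (toℕ a) (digitSum (α ∘ suc))))))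
      (residue-count (c + digitSum (α ∘ suc)))
      where
      regroup : ∀ c a s → c + a + s ≡ a + (c + s)
      regroup = solve-∀
    sum-slices (suc t) dim′ = trans
      (sum-cong-≗ {q} (λ a → planeSolutions-plane (free ∘ suc) (α ∘ suc) (c + toℕ a) dim′))
      (sum-const q (q ^ t))

  weight : ∀ {d} → Index (suc d) q → ℕ
  weight β = δ₀ (β zero) + digitSum (β ∘ suc)

  support : ∀ {d} → Index (suc d) q → Bool
  support β = divisibleᵇ (weight β)

  support-onPlane : ∀ {d t} (free : Fin (suc d) → Bool) α → numFree free ≡ 2 + t →
    count (λ β → onPlane free α β ∧ support β) (allIndices (suc d) q) ≡ q ^ suc t
  support-onPlane {t = t} free α dim with numFree-head free dim
  ... | inj₁ (eq , dim′) = trans (count-onPlane-free free α support eq) (trans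
    (sum-cong-≗ {q} (λ a → planeSolutions-plane (free ∘ suc) (α ∘ suc) (δ₀ a) (ℕₚ.suc-injective dim′)))
    (sum-const q (q ^ t)))
  ... | inj₂ (eq , dim′) =
    trans (count-onPlane-fixed free α support eq) (planeSolutions-plane (free ∘ suc) (α ∘ suc) (δ₀ (α zero)) dim′)

  diagonal-weight-sum : ∀ {d} {D : Fin q → Index (suc d) q} → isDiagonalᵇ D ≡ true →
    sum (weight ∘ D) ≡ 1 + d * sum {q} toℕ
  diagonal-weight-sum {d} {D} diagonal = begin
    sum (weight ∘ D)                                                    ≡⟨ ∑-distrib-+ {q} (λ k → δ₀ (D k zero)) (λ k → digitSum (D k ∘ suc)) ⟩
    sum (λ k → δ₀ (D k zero)) + sum (λ k → digitSum (D k ∘ suc))       ≡⟨ cong₂ _+_ heads columns ⟩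
    1 + d * sum {q} toℕ                                                 ∎
    where
    open ≡-Reasoning
    heads : sum {q} (λ k → δ₀ (D k zero)) ≡ 1
    heads = trans (sum-cong-≗ {q} (cong δ₀ ∘ diagonal-head {D = D} diagonal)) (sum-δ₀ m)
    columns : sum {q} (λ k → digitSum (D k ∘ suc)) ≡ d * sum {q} toℕ
    columns = begin
      sum {q} (λ k → sum (λ s → toℕ (D k (suc s))))   ≡⟨ ∑-comm {q} {d} (λ k s → toℕ (D k (suc s))) ⟩
      sum {d} (λ s → sum {q} (λ k → toℕ (D k (suc s)))) ≡⟨ sum-cong-≗ {d} (λ s →
                                                            sum-reindex-injective toℕ (diagonal-column-injective {D = D} diagonal (suc s))) ⟩
      sum {d} (λ _ → sum {q} toℕ)                       ≡⟨ sum-const d _ ⟩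
      d * sum {q} toℕ                                   ∎

  diagonal-leaves-support : ∀ {d h} → q ≡ 1 + 2 * h → 1 < q → ∀ (D : Fin q → Index (suc d) q) →
    isDiagonalᵇ D ≡ true → allᵇ (support ∘ D) (allFin q) ≡ false
  diagonal-leaves-support {d} {h} odd nontrivial D diagonal with allᵇ (support ∘ D) (allFin q) in on-support
  ... | false = refl
  ... | true = contradiction (sym (∣1⇒≡1 q∣1)) (ℕₚ.<⇒≢ nontrivial)
    where
    q∣weights : q ∣ sum (weight ∘ D)
    q∣weights = ∣-sum (weight ∘ D) (λ k → isYes⇒ (q ∣? weight (D k)) (allᵇ-allFin⁻ on-support k))
    q∣columns : q ∣ d * sum {q} toℕ
    q∣columns = ∣n⇒∣m*n d (subst (λ r → r ∣ sum {r} toℕ) (sym odd) (odd∣sum-toℕ h))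
    q∣1 : q ∣ 1
    q∣1 = ∣m+n∣m⇒∣n (subst (q ∣_) (trans (diagonal-weight-sum {d} {D} diagonal) (ℕₚ.+-comm 1 _)) q∣weights) q∣columns

  private instance
    q-positive : ℚ.Positive (q ×ℚ ℚ.1ℚ)
    q-positive = ℚₚ.pos+nonNeg⇒pos ℚ.1ℚ (m ×ℚ ℚ.1ℚ) {{×1ℚ-nonNeg m}}

    q-nonZero : ℚ.NonZero (q ×ℚ ℚ.1ℚ)
    q-nonZero = ℚₚ.pos⇒nonZero (q ×ℚ ℚ.1ℚ)

  q⁻¹ : ℚ.ℚ
  q⁻¹ = ℚ.1/ (q ×ℚ ℚ.1ℚ)

  q⁻¹-nonNeg : 0ℚ ℚ.≤ q⁻¹
  q⁻¹-nonNeg = ℚₚ.<⇒≤ (ℚₚ.positive⁻¹ q⁻¹ {{ℚₚ.1/pos⇒pos (q ×ℚ ℚ.1ℚ)}})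

  q×q⁻¹ : q ×ℚ q⁻¹ ≡ ℚ.1ℚ
  q×q⁻¹ = begin
    q ×ℚ q⁻¹              ≡⟨ cong (q ×ℚ_) (sym (ℚₚ.*-identityˡ q⁻¹)) ⟩
    q ×ℚ (ℚ.1ℚ ℚ.* q⁻¹)   ≡⟨ sym (×-assoc-* q ℚ.1ℚ q⁻¹) ⟩
    (q ×ℚ ℚ.1ℚ) ℚ.* q⁻¹   ≡⟨ ℚₚ.*-inverseʳ (q ×ℚ ℚ.1ℚ) ⟩
    ℚ.1ℚ                   ∎
    where open ≡-Reasoning

  residueMatrix : ∀ {d} → Matrix (suc d) q
  residueMatrix = indicator support q⁻¹

  residueMatrix-stochastic : ∀ {d} → IsStochastic 2 (residueMatrix {d})
  residueMatrix-stochastic {d} = indicator-nonNeg support q⁻¹-nonNeg , λ free α dim → begin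
    planeSum residueMatrix free α
      ≡⟨ sumℚ-indicator-filter support (onPlane free α) q⁻¹ (allIndices (suc d) q) ⟩
    count (λ β → onPlane free α β ∧ support β) (allIndices (suc d) q) ×ℚ q⁻¹
      ≡⟨ cong (_×ℚ q⁻¹) (trans (support-onPlane free α dim) (ℕₚ.*-identityʳ q)) ⟩
    q ×ℚ q⁻¹
      ≡⟨ q×q⁻¹ ⟩
    ℚ.1ℚ ∎
    where open ≡-Reasoning

  residueMatrix-permanent : ∀ {d h} → q ≡ 1 + 2 * h → 1 < q → permanent (residueMatrix {d}) ≡ 0ℚ
  residueMatrix-permanent {d} {h} odd nontrivial =
    permanent-indicator {d} support q⁻¹ (diagonal-leaves-support {d} {h} odd nontrivial)

theorem4 : (n q : ℕ) → 1 < n → (∃ λ k → q ≡ 1 + 2 * k) → 3 ≤ q →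
    Σ (Matrix (2 + n) q) (λ M → IsStochastic 2 M × permanent M ≡ 0ℚ)
theorem4 n (suc m) _ (h , odd) (s≤s 2≤m) =
  residueMatrix , residueMatrix-stochastic , residueMatrix-permanent {suc n} {h} odd 1<q
  where
  open Modulo m
  1<q : 1 < q
  1<q = s≤s (ℕₚ.≤-trans (s≤s z≤n) 2≤m)
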